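{- Let $m\geq 0$ and $k\geq m+2$ be integers, let $S=\{0,1,\dots,m\}$, and let $G=J_S(3k-2m-1,k)$. Let $C$ be the set of vertices $c$ of $G$ with $\{1,\dots,k-1\}\subset c$. Then $C$ is a (Godsil–McKay) switching set in $G$.
   Context: For integers $n\geq k\geq 2$ and $S\subseteq\{0,1,\dots,k-1\}$, $J_S(n,k)$ is the graph whose vertices are the $k$-subsets of $[n]=\{1,\dots,n\}$, two $k$-subsets $A,B$ being adjacent if $|A\cap B|\in S$. A subset $C$ of the vertex set of a graph $G$ is a (Godsil–McKay) switching set if (1) any two vertices of $C$ have the same number of neighbours in $C$, and (2) every vertex of $G$ not in $C$ is adjacent to exactly $0$, $|C|/2$ or $|C|$ vertices of $C$. -}

module Defs where

open import Data.Nat using (ℕ; zero; suc; _+_; _*_; _∸_; _≤_; _≤?_; _≟_)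
open import Data.Bool using (Bool; true; false)
open import Data.Vec using ([]; _∷_)
open import Data.List using (List; []; _∷_; map; _++_; filter; length)
open import Data.Fin using (Fin; toℕ)
open import Data.Fin.Subset using (Subset; _∈_; _∩_; ∣_∣)
open import Data.Fin.Subset.Properties using (_∈?_)
open import Data.Sum using (_⊎_)
open import Data.Product using (_×_)
open import Relation.Nullary using (Dec; ¬_)
open import Relation.Unary using (Pred; Decidable)
open import Relation.Binary.PropositionalEquality using (_≡_)
open import Level using (0ℓ)
open import Data.Fin.Properties using (all?)
open import Relation.Nullary.Decidable using (_→-dec_)

-- A finite (simple) graph presented by a duplicate-free complete list of
-- vertices (a predicate `IsVertex` on an ambient type, with an explicit
-- enumeration) and a decidable adjacency relation.
record FinGraph : Set₁ where
  field
    V        : Set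
    IsVertex : V → Set
    vertices : List V
    Adj      : V → V → Set
    adj?     : (u v : V) → Dec (Adj u v)

allSubsets : (n : ℕ) → List (Subset n)
allSubsets zero    = [] ∷ []
allSubsets (suc n) = map (true ∷_) (allSubsets n) ++ map (false ∷_) (allSubsets n)

-- J_S(n,k): vertices are the k-subsets of [n] (here [n] is modelled by Fin n,
-- element i standing for i+1); A ~ B iff |A ∩ B| ∈ S, with S a decidable set
-- of naturals.
J : (S : Pred ℕ 0ℓ) → Decidable S → (n k : ℕ) → FinGraph
J S S? n k = record
  { V        = Subset n
  ; IsVertex = λ A → ∣ A ∣ ≡ k
  ; vertices = filter (λ A → ∣ A ∣ ≟ k) (allSubsets n)
  ; Adj      = λ A B → S ∣ A ∩ B ∣
  ; adj?     = λ A B → S? ∣ A ∩ B ∣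
  }

module _ (G : FinGraph) where
  open FinGraph G

  degIn : (C : Pred V 0ℓ) → Decidable C → V → ℕ
  degIn C C? v = length (filter (λ w → C? w) (filter (λ w → adj? v w) vertices))

  sizeIn : (C : Pred V 0ℓ) → Decidable C → ℕ
  sizeIn C C? = length (filter (λ w → C? w) vertices)

  IsSwitchingSet : (C : Pred V 0ℓ) → Decidable C → Set
  IsSwitchingSet C C? =
    ((u v : V) → IsVertex u → IsVertex v → C u → C v →
       degIn C C? u ≡ degIn C C? v)
    ×
    ((v : V) → IsVertex v → ¬ C v →
       (degIn C C? v ≡ 0) ⊎ (2 * degIn C C? v ≡ sizeIn C C?) ⊎ (degIn C C? v ≡ sizeIn C C?))

upToSet : ℕ → Pred ℕ 0ℓ
upToSet m i = i ≤ m

upToSet? : (m : ℕ) → Decidable (upToSet m)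
upToSet? m i = i ≤? m

-- C: the k-subsets c with {1,...,k-1} ⊆ c, i.e. (0-based) every i with toℕ i < k-1 lies in c
-- (the vertex condition |c| = k is imposed separately by IsVertex / the enumeration).
Contains1toKm1 : {n : ℕ} (k : ℕ) → Subset n → Set
Contains1toKm1 k c = ∀ i → suc (toℕ i) ≤ k ∸ 1 → i ∈ c

contains1toKm1? : {n : ℕ} (k : ℕ) → Decidable (Contains1toKm1 {n} k)
contains1toKm1? k c = all? (λ i → (suc (toℕ i) ≤? k ∸ 1) →-dec (i ∈? c))

module Submission where

-- Write k = p + 1 and n = 3k − 2m − 1 = p + r with r = 2(k − m),
-- and split every subset v of [n] as v = v₁ ++ v₂ with v₁ ⊆ [p] (the anchor
-- {1,…,k−1}) and v₂ ⊆ the remaining r points.  The members of C are exactly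
-- the sets [p] ∪ {j} for the r points j outside the anchor, so for any vertex v
--   deg_C(v) = (r − |v₂|)·[|v₁| ∈ S] + |v₂|·[|v₁| + 1 ∈ S],        |C| = r.
-- With S = {0,…,m}: if |v₁| < m the degree is r = |C|; if |v₁| > m it is 0
-- (in particular for every v ∈ C, as |v₁| = p > m); if |v₁| = m then
-- |v₂| = k − m = r/2 and the degree is r − |v₂| = |C|/2.

open import Defs
open import Data.Nat using (ℕ; zero; suc; _+_; _*_; _∸_; _≤_; _<_; z≤n; s≤s; _≟_; _≤?_)
open import Data.Nat.Properties
open import Data.Bool using (true; false; if_then_else_)
open import Data.Vec using ([]; _∷_; _++_; splitAt)
open import Data.List using (List; []; _∷_; map; filter; length) renaming (_++_ to _++ₗ_)
open import Data.Fin using (zero; suc)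
open import Data.Fin.Subset using (Subset; _∩_; ∣_∣)
open import Data.Product using (_,_)
open import Data.Sum using (_⊎_; inj₁; inj₂)
open import Relation.Nullary using (Dec; yes; no; does; ¬_)
open import Relation.Unary using (Pred; Decidable)
open import Relation.Binary.PropositionalEquality hiding (J)
open import Relation.Binary.Definitions using (tri<; tri≈; tri>)
open import Data.Empty using (⊥-elim)
open import Data.Vec.Base using (here; there)
open import Level using (0ℓ)
open import Data.Nat.Tactic.RingSolver using (solve-∀)
open import Algebra.Properties.CommutativeSemigroup +-commutativeSemigroup using (x∙yz≈y∙xz)

χ : ∀ {A : Set} → Dec A → ℕ
χ d = if does d then 1 else 0

χ-cong : ∀ {A B : Set} → (A → B) → (B → A) → (a : Dec A) (b : Dec B) → χ a ≡ χ b
χ-cong f g (yes a) (yes b) = refl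
χ-cong f g (yes a) (no ¬b) = ⊥-elim (¬b (f a))
χ-cong f g (no ¬a) (yes b) = ⊥-elim (¬a (g b))
χ-cong f g (no _)  (no _)  = refl

χ-yes : ∀ {A : Set} → A → (a : Dec A) → χ a ≡ 1
χ-yes x (yes _) = refl
χ-yes x (no ¬x) = ⊥-elim (¬x x)

χ-no : ∀ {A : Set} → ¬ A → (a : Dec A) → χ a ≡ 0
χ-no ¬x (yes x) = ⊥-elim (¬x x)
χ-no ¬x (no _)  = refl

sumOver : ∀ {A : Set} → (A → ℕ) → List A → ℕ
sumOver f []       = 0
sumOver f (x ∷ xs) = f x + sumOver f xs

sumOver-cong : ∀ {A : Set} {f g : A → ℕ} → (∀ x → f x ≡ g x) →
               ∀ xs → sumOver f xs ≡ sumOver g xs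
sumOver-cong e []       = refl
sumOver-cong e (x ∷ xs) = cong₂ _+_ (e x) (sumOver-cong e xs)

sumOver-zero : ∀ {A : Set} (f : A → ℕ) → (∀ x → f x ≡ 0) → ∀ xs → sumOver f xs ≡ 0
sumOver-zero f e []       = refl
sumOver-zero f e (x ∷ xs) = cong₂ _+_ (e x) (sumOver-zero f e xs)

sumOver-++ : ∀ {A : Set} (f : A → ℕ) xs ys →
             sumOver f (xs ++ₗ ys) ≡ sumOver f xs + sumOver f ys
sumOver-++ f []       ys = refl
sumOver-++ f (x ∷ xs) ys = trans (cong (f x +_) (sumOver-++ f xs ys)) (sym (+-assoc (f x) _ _))

sumOver-map : ∀ {A B : Set} (f : B → ℕ) (h : A → B) xs →
              sumOver f (map h xs) ≡ sumOver (λ x → f (h x)) xs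
sumOver-map f h []       = refl
sumOver-map f h (x ∷ xs) = cong (f (h x) +_) (sumOver-map f h xs)

sumOver-filter : ∀ {A : Set} {P : A → Set} (P? : (x : A) → Dec (P x)) (f : A → ℕ) xs →
                 sumOver f (filter P? xs) ≡ sumOver (λ x → χ (P? x) * f x) xs
sumOver-filter P? f [] = refl
sumOver-filter P? f (x ∷ xs) with P? x
... | yes _ = cong₂ _+_ (sym (+-identityʳ (f x))) (sumOver-filter P? f xs)
... | no _  = sumOver-filter P? f xs

length-filter : ∀ {A : Set} {P : A → Set} (P? : (x : A) → Dec (P x)) xs →
                length (filter P? xs) ≡ sumOver (λ x → χ (P? x)) xs
length-filter P? [] = refl
length-filter P? (x ∷ xs) with P? x
... | yes _ = cong suc (length-filter P? xs)
... | no _  = length-filter P? xs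

sumOver-allSubsets : ∀ n (f : Subset (suc n) → ℕ) →
  sumOver f (allSubsets (suc n)) ≡
  sumOver (λ w → f (true ∷ w)) (allSubsets n) + sumOver (λ w → f (false ∷ w)) (allSubsets n)
sumOver-allSubsets n f =
  trans (sumOver-++ f (map (true ∷_) (allSubsets n)) (map (false ∷_) (allSubsets n)))
        (cong₂ _+_ (sumOver-map f (true ∷_) (allSubsets n)) (sumOver-map f (false ∷_) (allSubsets n)))

∅ : ∀ r → Subset r
∅ zero    = []
∅ (suc r) = false ∷ ∅ r

∩-∅ : ∀ {r} (v : Subset r) → ∣ v ∩ ∅ r ∣ ≡ 0
∩-∅ []          = refl
∩-∅ (true ∷ v)  = ∩-∅ v
∩-∅ (false ∷ v) = ∩-∅ v

gaps : ∀ {r} → Subset r → ℕ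
gaps []          = 0
gaps (true ∷ v)  = gaps v
gaps (false ∷ v) = suc (gaps v)

gaps+size : ∀ {r} (v : Subset r) → gaps v + ∣ v ∣ ≡ r
gaps+size []          = refl
gaps+size (true ∷ v)  = trans (+-suc (gaps v) ∣ v ∣) (cong suc (gaps+size v))
gaps+size (false ∷ v) = cong suc (gaps+size v)

size-++ : ∀ {p r} (v₁ : Subset p) (v₂ : Subset r) → ∣ v₁ ++ v₂ ∣ ≡ ∣ v₁ ∣ + ∣ v₂ ∣
size-++ []           v₂ = refl
size-++ (true ∷ v₁)  v₂ = cong suc (size-++ v₁ v₂)
size-++ (false ∷ v₁) v₂ = size-++ v₁ v₂

-- The empty set is the only subset of size 0.
sumOver-size0 : ∀ r (H : Subset r → ℕ) →
  sumOver (λ w → χ (∣ w ∣ ≟ 0) * H w) (allSubsets r) ≡ H (∅ r)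
sumOver-size0 zero    H = trans (+-identityʳ _) (+-identityʳ (H []))
sumOver-size0 (suc r) H = begin
    sumOver (λ w → χ (∣ w ∣ ≟ 0) * H w) (allSubsets (suc r))
  ≡⟨ sumOver-allSubsets r _ ⟩
    sumOver (λ w → χ (suc ∣ w ∣ ≟ 0) * H (true ∷ w)) (allSubsets r)
      + sumOver (λ w → χ (∣ w ∣ ≟ 0) * H (false ∷ w)) (allSubsets r)
  ≡⟨ cong₂ _+_ (sumOver-zero _ (λ w → cong (_* H (true ∷ w)) (χ-no (λ ()) (suc ∣ w ∣ ≟ 0))) (allSubsets r))
               (sumOver-size0 r (λ w → H (false ∷ w))) ⟩
    H (∅ (suc r)) ∎
  where open ≡-Reasoning

-- Over the singletons {j}, a function of |v ∩ {j}| takes the value Q 1 for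
-- the |v| points j ∈ v and Q 0 for the gaps v other points.
sumOver-singletons : ∀ r (v : Subset r) (Q : ℕ → ℕ) →
  sumOver (λ w → χ (∣ w ∣ ≟ 1) * Q ∣ v ∩ w ∣) (allSubsets r) ≡ gaps v * Q 0 + ∣ v ∣ * Q 1
sumOver-singletons zero    []      Q = refl
sumOver-singletons (suc r) (b ∷ v) Q = begin
    sumOver (λ w → χ (∣ w ∣ ≟ 1) * Q ∣ (b ∷ v) ∩ w ∣) (allSubsets (suc r))
  ≡⟨ sumOver-allSubsets r _ ⟩
    sumOver (λ w → χ (suc ∣ w ∣ ≟ 1) * Q ∣ (b ∷ v) ∩ (true ∷ w) ∣) (allSubsets r)
      + sumOver (λ w → χ (∣ w ∣ ≟ 1) * Q ∣ (b ∷ v) ∩ (false ∷ w) ∣) (allSubsets r)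
  ≡⟨ cong₂ _+_ (sumOver-cong (λ w → cong (_* Q ∣ (b ∷ v) ∩ (true ∷ w) ∣)
                                          (χ-cong suc-injective (cong suc) (suc ∣ w ∣ ≟ 1) (∣ w ∣ ≟ 0)))
                             (allSubsets r))
               (sumOver-cong (λ w → cong (λ x → χ (∣ w ∣ ≟ 1) * Q x) (tail-∩ b w)) (allSubsets r)) ⟩
    sumOver (λ w → χ (∣ w ∣ ≟ 0) * Q ∣ (b ∷ v) ∩ (true ∷ w) ∣) (allSubsets r)
      + sumOver (λ w → χ (∣ w ∣ ≟ 1) * Q ∣ v ∩ w ∣) (allSubsets r)
  ≡⟨ cong₂ _+_ (sumOver-size0 r (λ w → Q ∣ (b ∷ v) ∩ (true ∷ w) ∣)) (sumOver-singletons r v Q) ⟩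
    Q ∣ (b ∷ v) ∩ (true ∷ ∅ r) ∣ + (gaps v * Q 0 + ∣ v ∣ * Q 1)
  ≡⟨ head-term b ⟩
    gaps (b ∷ v) * Q 0 + ∣ b ∷ v ∣ * Q 1 ∎
  where
  open ≡-Reasoning
  tail-∩ : ∀ b w → ∣ (b ∷ v) ∩ (false ∷ w) ∣ ≡ ∣ v ∩ w ∣
  tail-∩ true  w = refl
  tail-∩ false w = refl
  head-term : ∀ b → Q ∣ (b ∷ v) ∩ (true ∷ ∅ r) ∣ + (gaps v * Q 0 + ∣ v ∣ * Q 1)
                    ≡ gaps (b ∷ v) * Q 0 + ∣ b ∷ v ∣ * Q 1
  head-term true  rewrite ∩-∅ v = x∙yz≈y∙xz (Q 1) (gaps v * Q 0) (∣ v ∣ * Q 1)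
  head-term false rewrite ∩-∅ v = sym (+-assoc (Q 0) (gaps v * Q 0) (∣ v ∣ * Q 1))

-- Anchored sets: subsets of Fin (p + r) containing the first p points
-- (Contains1toKm1 (suc p), since the anchor is {1,…,k−1} with k = p + 1).

anchored-step⇒ : ∀ {n} p (w : Subset n) →
                 Contains1toKm1 (suc (suc p)) (true ∷ w) → Contains1toKm1 (suc p) w
anchored-step⇒ p w h i le with h (suc i) (s≤s le)
... | there i∈w = i∈w

anchored-step⇐ : ∀ {n} p (w : Subset n) →
                 Contains1toKm1 (suc p) w → Contains1toKm1 (suc (suc p)) (true ∷ w)
anchored-step⇐ p w h zero    le       = here
anchored-step⇐ p w h (suc i) (s≤s le) = there (h i le)

anchored-head : ∀ {n} p (w : Subset n) → ¬ Contains1toKm1 (suc (suc p)) (false ∷ w)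
anchored-head p w h with h zero (s≤s z≤n)
... | ()

anchored⇒full : ∀ p {r} (v₁ : Subset p) (v₂ : Subset r) →
                Contains1toKm1 (suc p) (v₁ ++ v₂) → ∣ v₁ ∣ ≡ p
anchored⇒full zero    []           v₂ h = refl
anchored⇒full (suc p) (true ∷ v₁)  v₂ h = cong suc (anchored⇒full p v₁ v₂ (anchored-step⇒ p (v₁ ++ v₂) h))
anchored⇒full (suc p) (false ∷ v₁) v₂ h = ⊥-elim (anchored-head p (v₁ ++ v₂) h)

-- The key count: summing a function Q of |v ∩ w| over the anchored w of
-- size p + 1 (i.e. w = [p] ∪ {j}) gives the formula stated in the header.
anchoredSum : ∀ p r → Subset (p + r) → (ℕ → ℕ) → ℕ
anchoredSum p r v Q = sumOver (λ w → χ (∣ w ∣ ≟ suc p) * (Q ∣ v ∩ w ∣ * χ (contains1toKm1? (suc p) w)))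
                              (allSubsets (p + r))

anchoredSum-formula : ∀ p r (v₁ : Subset p) (v₂ : Subset r) (Q : ℕ → ℕ) →
  anchoredSum p r (v₁ ++ v₂) Q ≡ gaps v₂ * Q ∣ v₁ ∣ + ∣ v₂ ∣ * Q (suc ∣ v₁ ∣)
anchoredSum-formula zero r [] v₂ Q =
  trans (sumOver-cong unanchored (allSubsets r)) (sumOver-singletons r v₂ Q)
  where
  unanchored : ∀ w → χ (∣ w ∣ ≟ 1) * (Q ∣ v₂ ∩ w ∣ * χ (contains1toKm1? 1 w)) ≡ χ (∣ w ∣ ≟ 1) * Q ∣ v₂ ∩ w ∣
  unanchored w rewrite χ-yes {A = Contains1toKm1 1 w} (λ i ()) (contains1toKm1? 1 w)
                     | *-identityʳ (Q ∣ v₂ ∩ w ∣) = refl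
anchoredSum-formula (suc p) r (b ∷ v₁) v₂ Q = begin
    anchoredSum (suc p) r (b ∷ (v₁ ++ v₂)) Q
  ≡⟨ sumOver-allSubsets (p + r) _ ⟩
    sumOver (λ w → χ (suc ∣ w ∣ ≟ suc (suc p)) * (Q ∣ (b ∷ (v₁ ++ v₂)) ∩ (true ∷ w) ∣
                     * χ (contains1toKm1? (suc (suc p)) (true ∷ w)))) (allSubsets (p + r))
      + sumOver (λ w → χ (∣ w ∣ ≟ suc (suc p)) * (Q ∣ (b ∷ (v₁ ++ v₂)) ∩ (false ∷ w) ∣
                     * χ (contains1toKm1? (suc (suc p)) (false ∷ w)))) (allSubsets (p + r))
  ≡⟨ cong₂ _+_ (sumOver-cong head-in (allSubsets (p + r))) (sumOver-zero _ head-out (allSubsets (p + r))) ⟩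
    anchoredSum p r (v₁ ++ v₂) Q′ + 0
  ≡⟨ +-identityʳ _ ⟩
    anchoredSum p r (v₁ ++ v₂) Q′
  ≡⟨ anchoredSum-formula p r v₁ v₂ Q′ ⟩
    gaps v₂ * Q′ ∣ v₁ ∣ + ∣ v₂ ∣ * Q′ (suc ∣ v₁ ∣)
  ≡⟨ shift b ⟩
    gaps v₂ * Q ∣ b ∷ v₁ ∣ + ∣ v₂ ∣ * Q (suc ∣ b ∷ v₁ ∣) ∎
  where
  open ≡-Reasoning
  -- The head point lies in every anchored w; it adds 1 to |v ∩ w| iff b.
  Q′ : ℕ → ℕ
  Q′ j = Q (∣ b ∷ [] ∣ + j)
  shift : ∀ b → gaps v₂ * Q (∣ b ∷ [] ∣ + ∣ v₁ ∣) + ∣ v₂ ∣ * Q (∣ b ∷ [] ∣ + suc ∣ v₁ ∣)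
                ≡ gaps v₂ * Q ∣ b ∷ v₁ ∣ + ∣ v₂ ∣ * Q (suc ∣ b ∷ v₁ ∣)
  shift true  = refl
  shift false = refl
  head-∩ : ∀ b w → ∣ (b ∷ (v₁ ++ v₂)) ∩ (true ∷ w) ∣ ≡ ∣ b ∷ [] ∣ + ∣ (v₁ ++ v₂) ∩ w ∣
  head-∩ true  w = refl
  head-∩ false w = refl
  head-in : ∀ w → χ (suc ∣ w ∣ ≟ suc (suc p)) * (Q ∣ (b ∷ (v₁ ++ v₂)) ∩ (true ∷ w) ∣
                    * χ (contains1toKm1? (suc (suc p)) (true ∷ w)))
                  ≡ χ (∣ w ∣ ≟ suc p) * (Q′ ∣ (v₁ ++ v₂) ∩ w ∣ * χ (contains1toKm1? (suc p) w))
  head-in w = cong₂ _*_ (χ-cong suc-injective (cong suc) (suc ∣ w ∣ ≟ suc (suc p)) (∣ w ∣ ≟ suc p))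
                (cong₂ _*_ (cong Q (head-∩ b w))
                  (χ-cong (anchored-step⇒ p w) (anchored-step⇐ p w)
                          (contains1toKm1? (suc (suc p)) (true ∷ w)) (contains1toKm1? (suc p) w)))
  head-out : ∀ w → χ (∣ w ∣ ≟ suc (suc p)) * (Q ∣ (b ∷ (v₁ ++ v₂)) ∩ (false ∷ w) ∣
                     * χ (contains1toKm1? (suc (suc p)) (false ∷ w))) ≡ 0
  head-out w rewrite χ-no (anchored-head p w) (contains1toKm1? (suc (suc p)) (false ∷ w))
                   | *-zeroʳ (Q ∣ (b ∷ (v₁ ++ v₂)) ∩ (false ∷ w) ∣) = *-zeroʳ (χ (∣ w ∣ ≟ suc (suc p)))

module AnchoredDegrees (S : Pred ℕ 0ℓ) (S? : Decidable S) (p r : ℕ) where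

  G : FinGraph
  G = J S S? (p + r) (suc p)

  C : Pred (Subset (p + r)) 0ℓ
  C = Contains1toKm1 (suc p)

  C? : Decidable C
  C? = contains1toKm1? (suc p)

  degree : ∀ (v₁ : Subset p) (v₂ : Subset r) →
           degIn G C C? (v₁ ++ v₂) ≡ gaps v₂ * χ (S? ∣ v₁ ∣) + ∣ v₂ ∣ * χ (S? (suc ∣ v₁ ∣))
  degree v₁ v₂ = begin
      length (filter C? (filter adjacent? vertices))
    ≡⟨ length-filter C? (filter adjacent? vertices) ⟩
      sumOver (λ w → χ (C? w)) (filter adjacent? vertices)
    ≡⟨ sumOver-filter adjacent? (λ w → χ (C? w)) vertices ⟩
      sumOver (λ w → χ (adjacent? w) * χ (C? w)) vertices
    ≡⟨ sumOver-filter (λ w → ∣ w ∣ ≟ suc p) (λ w → χ (adjacent? w) * χ (C? w)) (allSubsets (p + r)) ⟩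
      anchoredSum p r v (λ i → χ (S? i))
    ≡⟨ anchoredSum-formula p r v₁ v₂ (λ i → χ (S? i)) ⟩
      gaps v₂ * χ (S? ∣ v₁ ∣) + ∣ v₂ ∣ * χ (S? (suc ∣ v₁ ∣)) ∎
    where
    open ≡-Reasoning
    open FinGraph G using (vertices)
    v : Subset (p + r)
    v = v₁ ++ v₂
    adjacent? : (w : Subset (p + r)) → Dec (S ∣ v ∩ w ∣)
    adjacent? w = S? ∣ v ∩ w ∣

  -- |C| = r: one member [p] ∪ {j} for each point j outside the anchor.
  size : sizeIn G C C? ≡ r
  size = begin
      length (filter C? vertices)
    ≡⟨ length-filter C? vertices ⟩
      sumOver (λ w → χ (C? w)) vertices
    ≡⟨ sumOver-filter (λ w → ∣ w ∣ ≟ suc p) (λ w → χ (C? w)) (allSubsets (p + r)) ⟩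
      sumOver (λ w → χ (∣ w ∣ ≟ suc p) * χ (C? w)) (allSubsets (p + r))
    ≡⟨ sumOver-cong (λ w → cong (χ (∣ w ∣ ≟ suc p) *_) (sym (*-identityˡ (χ (C? w))))) (allSubsets (p + r)) ⟩
      anchoredSum p r (∅ p ++ ∅ r) (λ _ → 1)
    ≡⟨ anchoredSum-formula p r (∅ p) (∅ r) (λ _ → 1) ⟩
      gaps (∅ r) * 1 + ∣ ∅ r ∣ * 1
    ≡⟨ cong₂ _+_ (*-identityʳ (gaps (∅ r))) (*-identityʳ ∣ ∅ r ∣) ⟩
      gaps (∅ r) + ∣ ∅ r ∣
    ≡⟨ gaps+size (∅ r) ⟩
      r ∎
    where
    open ≡-Reasoning
    open FinGraph G using (vertices)

-- S = {0,…,m} with m < p, and r = 2(k − m) points outside the anchor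

module IntervalSwitching (m p : ℕ) (m<p : m < p) where

  -- s = k − m with k = p + 1.
  s : ℕ
  s = suc p ∸ m

  open AnchoredDegrees (upToSet m) (upToSet? m) p (s + s)

  degree-large : ∀ (v₁ : Subset p) (v₂ : Subset (s + s)) → m < ∣ v₁ ∣ →
                 degIn G C C? (v₁ ++ v₂) ≡ 0
  degree-large v₁ v₂ m<v₁
    rewrite degree v₁ v₂
          | χ-no (<⇒≱ m<v₁) (∣ v₁ ∣ ≤? m)
          | χ-no (<⇒≱ (m<n⇒m<1+n m<v₁)) (suc ∣ v₁ ∣ ≤? m)
          | *-zeroʳ (gaps v₂) | *-zeroʳ ∣ v₂ ∣ = refl

  degree-small : ∀ (v₁ : Subset p) (v₂ : Subset (s + s)) → ∣ v₁ ∣ < m →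
                 degIn G C C? (v₁ ++ v₂) ≡ sizeIn G C C?
  degree-small v₁ v₂ v₁<m
    rewrite degree v₁ v₂ | size
          | χ-yes (<⇒≤ v₁<m) (∣ v₁ ∣ ≤? m) | χ-yes v₁<m (suc ∣ v₁ ∣ ≤? m)
          | *-identityʳ (gaps v₂) | *-identityʳ ∣ v₂ ∣ = gaps+size v₂

  -- If |v₁| = m, a k-set v = v₁ ++ v₂ has |v₂| = k − m = s, hence also
  -- s points outside v₂.
  middle-gaps : ∀ (v₁ : Subset p) (v₂ : Subset (s + s)) →
                ∣ v₁ ++ v₂ ∣ ≡ suc p → ∣ v₁ ∣ ≡ m → gaps v₂ ≡ s
  middle-gaps v₁ v₂ |v|≡k v₁≡m =
    +-cancelʳ-≡ ∣ v₂ ∣ (gaps v₂) s (trans (gaps+size v₂) (cong (s +_) (sym size≡s)))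
    where
    open ≡-Reasoning
    size≡s : ∣ v₂ ∣ ≡ s
    size≡s = begin
        ∣ v₂ ∣              ≡⟨ m+n∸m≡n m ∣ v₂ ∣ ⟨
        m + ∣ v₂ ∣ ∸ m      ≡⟨ cong (λ i → i + ∣ v₂ ∣ ∸ m) v₁≡m ⟨
        ∣ v₁ ∣ + ∣ v₂ ∣ ∸ m ≡⟨ cong (_∸ m) (size-++ v₁ v₂) ⟨
        ∣ v₁ ++ v₂ ∣ ∸ m    ≡⟨ cong (_∸ m) |v|≡k ⟩
        s ∎

  -- If |v₁| = m, v is adjacent exactly to the members [p] ∪ {j} with j ∉ v₂:
  -- half of C.
  degree-middle : ∀ (v₁ : Subset p) (v₂ : Subset (s + s)) →
                  ∣ v₁ ++ v₂ ∣ ≡ suc p → ∣ v₁ ∣ ≡ m →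
                  2 * degIn G C C? (v₁ ++ v₂) ≡ sizeIn G C C?
  degree-middle v₁ v₂ |v|≡k v₁≡m
    rewrite degree v₁ v₂ | size
          | χ-yes (≤-reflexive v₁≡m) (∣ v₁ ∣ ≤? m) | χ-no (<-irrefl v₁≡m) (suc ∣ v₁ ∣ ≤? m)
          | *-identityʳ (gaps v₂) | *-zeroʳ ∣ v₂ ∣ | +-identityʳ (gaps v₂)
          | middle-gaps v₁ v₂ |v|≡k v₁≡m
          = cong (s +_) (+-identityʳ s)

  -- Members of C have |v₁| = p > m, hence all have degree 0 into C.
  degree-in-C : ∀ (v₁ : Subset p) (v₂ : Subset (s + s)) → C (v₁ ++ v₂) →
                degIn G C C? (v₁ ++ v₂) ≡ 0
  degree-in-C v₁ v₂ v∈C =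
    degree-large v₁ v₂ (subst (m <_) (sym (anchored⇒full p v₁ v₂ v∈C)) m<p)

  switching : IsSwitchingSet G C C?
  switching = regular , outside
    where
    regular : ∀ u v → ∣ u ∣ ≡ suc p → ∣ v ∣ ≡ suc p → C u → C v →
              degIn G C C? u ≡ degIn G C C? v
    regular u v _ _ u∈C v∈C with splitAt p u | splitAt p v
    ... | u₁ , u₂ , refl | v₁ , v₂ , refl =
      trans (degree-in-C u₁ u₂ u∈C) (sym (degree-in-C v₁ v₂ v∈C))
    outside : ∀ v → ∣ v ∣ ≡ suc p → ¬ C v →
              (degIn G C C? v ≡ 0) ⊎ (2 * degIn G C C? v ≡ sizeIn G C C?) ⊎ (degIn G C C? v ≡ sizeIn G C C?)
    outside v |v|≡k _ with splitAt p v
    ... | v₁ , v₂ , refl with <-cmp ∣ v₁ ∣ m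
    ...   | tri< v₁<m _ _ = inj₂ (inj₂ (degree-small v₁ v₂ v₁<m))
    ...   | tri≈ _ v₁≡m _ = inj₂ (inj₁ (degree-middle v₁ v₂ |v|≡k v₁≡m))
    ...   | tri> _ _ m<v₁ = inj₁ (degree-large v₁ v₂ m<v₁)


order-as-anchor-plus-rest : ∀ m p → m ≤ suc p →
  3 * suc p ∸ 2 * m ∸ 1 ≡ p + ((suc p ∸ m) + (suc p ∸ m))
order-as-anchor-plus-rest m p m≤k = begin
    3 * suc p ∸ 2 * m ∸ 1                       ≡⟨ cong (λ x → 3 * x ∸ 2 * m ∸ 1) m+s≡k ⟨
    3 * (m + s) ∸ 2 * m ∸ 1                     ≡⟨ cong (λ x → x ∸ 2 * m ∸ 1) (expand m s) ⟩
    2 * m + ((m + s) + (s + s)) ∸ 2 * m ∸ 1     ≡⟨ cong (_∸ 1) (m+n∸m≡n (2 * m) ((m + s) + (s + s))) ⟩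
    (m + s) + (s + s) ∸ 1                       ≡⟨ cong (λ x → x + (s + s) ∸ 1) m+s≡k ⟩
    p + (s + s) ∎
  where
  open ≡-Reasoning
  s : ℕ
  s = suc p ∸ m
  m+s≡k : m + s ≡ suc p
  m+s≡k = m+[n∸m]≡n m≤k
  expand : ∀ m s → 3 * (m + s) ≡ 2 * m + ((m + s) + (s + s))
  expand = solve-∀

theorem6 : (m k : ℕ) → m + 2 ≤ k →
    IsSwitchingSet (J (upToSet m) (upToSet? m) (3 * k ∸ 2 * m ∸ 1) k)
                   (Contains1toKm1 k) (contains1toKm1? k)
theorem6 m zero m+2≤k with subst (_≤ 0) (+-comm m 2) m+2≤k
... | ()
theorem6 m (suc p) m+2≤k =
  subst (λ n → IsSwitchingSet (J (upToSet m) (upToSet? m) n (suc p))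
                              (Contains1toKm1 (suc p)) (contains1toKm1? (suc p)))
        (sym (order-as-anchor-plus-rest m p (≤-trans (m≤m+n m 2) m+2≤k)))
        (IntervalSwitching.switching m p m<p)
  where
  m<p : m < p
  m<p with subst (_≤ suc p) (+-comm m 2) m+2≤k
  ... | s≤s m<p = m<p
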